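{- Let $n$, $a$, $q$ be integers with $n=qa$ and $3\le q<a-1$, and suppose $a=kq+1+s$ with integers $k\ge 1$ and $0\le s\le q-1$. Then (1) if $s=0$, $\beta_b(\overrightarrow{C}(n;1,a))\ge a(q-1)$; (2) if $s=1$, $\beta_b(\overrightarrow{C}(n;1,a))\ge (a-1)(q-1)+1$; (3) if $s\ge 2$, $\beta_b(\overrightarrow{C}(n;1,a))\ge (a-s)(q-1)+s(s-1)$.
   Context: The oriented circulant graph $\overrightarrow{C}(n;1,a)$ has vertex set $\{v_0,\dots,v_{n-1}\}$ and arcs $v_iv_{i+1}$, $v_iv_{i+a}$, subscripts modulo $n$. $d(u,v)$ is the length of a shortest directed path from $u$ to $v$; $e(v)=\max_u d(v,u)$; $\mathrm{diam}$ is the maximum eccentricity. An independent broadcast is $f:V\to\{0,\dots,\mathrm{diam}\}$ with $f(v)\le e(v)$ for all $v$ and $d(u,v)>f(u)$ for all distinct $u,v$ with $f(u),f(v)>0$; its cost is $\sigma(f)=\sum_v f(v)$, and $\beta_b$ is the maximum cost of an independent broadcast. -}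

module Defs where

open import Data.Nat using (ℕ; zero; suc; _+_; _*_; _≤_; _<_)
open import Data.Fin using (Fin; toℕ)
open import Data.List using (tabulate)
open import Data.Nat.ListAction using (sum)
open import Data.Product using (Σ; ∃; _×_)
open import Data.Sum using (_⊎_)
open import Relation.Binary.PropositionalEquality using (_≡_; _≢_)

-- The oriented circulant graph C(n;1,a): vertices v_0..v_{n-1} = Fin n,
-- arcs v_i v_{i+1} and v_i v_{i+a}, subscripts modulo n.
-- "j ≡ i + c (mod n)" is written as: ∃ t. i + c ≡ j + t * n (j < n fixes j).
data Arc (n a : ℕ) (i j : Fin n) : Set where
  arc1 : (t : ℕ) → toℕ i + 1 ≡ toℕ j + t * n → Arc n a i j
  arca : (t : ℕ) → toℕ i + a ≡ toℕ j + t * n → Arc n a i j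

data Walk (n a : ℕ) : ℕ → Fin n → Fin n → Set where
  nil  : ∀ {v} → Walk n a 0 v v
  cons : ∀ {m u w v} → Arc n a u w → Walk n a m w v → Walk n a (suc m) u v

-- d(u,v) > r  :  every directed walk (hence every path) from u to v has length > r.
DistGt : (n a : ℕ) → Fin n → Fin n → ℕ → Set
DistGt n a u v r = ∀ m → Walk n a m u v → r < m

DistGe : (n a : ℕ) → Fin n → Fin n → ℕ → Set
DistGe n a u v r = ∀ m → Walk n a m u v → r ≤ m

-- r ≤ e(v) = max_u d(v,u)
EccGe : (n a : ℕ) → Fin n → ℕ → Set
EccGe n a v r = ∃ λ u → DistGe n a v u r

-- Independent broadcast on C(n;1,a).  (f(v) ≤ diam follows from f(v) ≤ e(v).)
record IndependentBroadcast (n a : ℕ) (f : Fin n → ℕ) : Set where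
  field
    bounded     : ∀ v → EccGe n a v (f v)
    independent : ∀ u v → u ≢ v → 0 < f u → 0 < f v → DistGt n a u v (f u)

cost : {n : ℕ} → (Fin n → ℕ) → ℕ
cost {n} f = sum (tabulate f)

-- c ≤ β_b(C(n;1,a)) : some independent broadcast has cost at least c
-- (β_b is the maximum cost over the finite nonempty set of independent broadcasts).
βb≥ : (n a c : ℕ) → Set
βb≥ n a c = Σ (Fin _ → ℕ) λ f → IndependentBroadcast n a f × c ≤ cost {n} f

-- Write a vertex i < q·a as i = r + m·a with column r < a and row m < q, and call it
-- diagonal when q ∣ r + m; each column contains exactly one diagonal vertex.  Given column
-- weights w, let the diagonal vertex of column r broadcast w(r).  A walk from (r₁, m₁) to
-- (r₂, m₂) using x < a unit arcs and y arcs of length a satisfies either r₁ + x = r₂ and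
-- m₁ + y ≡ m₂ (mod q), or r₁ + x = a + r₂ and m₁ + y + 1 ≡ m₂ (mod q).  Comparing r + m
-- modulo q and using a ≡ s + 1 (mod q), its length x + y is ≡ 0 in the first case and ≡ s
-- in the second.  So the broadcast is independent as soon as w(r) < q to the left of a
-- broadcasting column, w(r) < q + s for r ≤ kq and w(r) < s for r > kq.  Then w(r) < a, which
-- disposes of walks with x ≥ a and keeps the broadcast below the eccentricities, since every
-- vertex is at distance ≥ a − 1 from its cyclic predecessor.  The weights q − 1 up to column
-- kq (q on column kq itself when s = 1) and s − 1 beyond it give the three bounds.

module Submission where

open import Defs
open import Data.Nat
open import Data.Nat.Properties
open import Data.Nat.DivMod
open import Data.Nat.Divisibility
open import Data.Nat.Tactic.RingSolver using (solve-∀)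
open import Data.Fin using (Fin; toℕ; zero; suc; fromℕ; fromℕ<; inject₁)
open import Data.Fin.Properties using (toℕ-injective; toℕ<n; toℕ-fromℕ; toℕ-fromℕ<; toℕ-inject₁)
open import Data.Product using (∃; ∃₂; _×_; _,_; proj₁; proj₂)
open import Data.Sum using (_⊎_; inj₁; inj₂)
open import Function using (_∘_)
open import Relation.Binary.Definitions using (tri<; tri≈; tri>)
open import Relation.Binary.PropositionalEquality
open import Relation.Nullary using (¬_; yes; no)
open import Relation.Nullary.Negation using (contradiction)
open import Algebra.Properties.CommutativeSemigroup +-commutativeSemigroup
  using (interchange; x∙yz≈y∙xz; xy∙z≈xz∙y)
open import Algebra.Properties.CommutativeMonoid.Sum +-0-commutativeMonoid
  using (sum-syntax; sum-cong-≗; sum-remove; ∑-comm)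

cost≡∑ : ∀ {n} (f : Fin n → ℕ) → cost f ≡ ∑[ i < n ] f i
cost≡∑ {zero}  f = refl
cost≡∑ {suc n} f = cong (f zero +_) (cost≡∑ (f ∘ suc))

∑-mono-≤ : ∀ {n} {f g : Fin n → ℕ} → (∀ i → f i ≤ g i) → ∑[ i < n ] f i ≤ ∑[ i < n ] g i
∑-mono-≤ {zero}  f≤g = z≤n
∑-mono-≤ {suc n} f≤g = +-mono-≤ (f≤g zero) (∑-mono-≤ (f≤g ∘ suc))

≤-∑ : ∀ {n} (f : Fin n → ℕ) (i : Fin n) → f i ≤ ∑[ j < n ] f j
≤-∑ {suc n} f i = ≤-trans (m≤m+n (f i) _) (≤-reflexive (sym (sum-remove {i = i} f)))

∑-const : ∀ n c → ∑[ i < n ] c ≡ n * c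
∑-const zero    c = refl
∑-const (suc n) c = cong (c +_) (∑-const n c)

∑-++ : ∀ m n (F : ℕ → ℕ) →
  ∑[ i < m + n ] F (toℕ i) ≡ ∑[ i < m ] F (toℕ i) + ∑[ j < n ] F (m + toℕ j)
∑-++ zero    n F = refl
∑-++ (suc m) n F = trans (cong (F 0 +_) (∑-++ m n (F ∘ suc))) (sym (+-assoc (F 0) _ _))

∑-rows : ∀ m n (F : ℕ → ℕ) →
  ∑[ i < m * n ] F (toℕ i) ≡ ∑[ i < m ] ∑[ j < n ] F (toℕ i * n + toℕ j)
∑-rows zero    n F = refl
∑-rows (suc m) n F = begin
  ∑[ i < n + m * n ] F (toℕ i)
    ≡⟨ ∑-++ n (m * n) F ⟩
  ∑[ j < n ] F (toℕ j) + ∑[ i < m * n ] F (n + toℕ i)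
    ≡⟨ cong (∑[ j < n ] F (toℕ j) +_) (∑-rows m n (F ∘ (n +_))) ⟩
  ∑[ j < n ] F (toℕ j) + ∑[ i < m ] ∑[ j < n ] F (n + (toℕ i * n + toℕ j))
    ≡⟨ cong (∑[ j < n ] F (toℕ j) +_)
         (sum-cong-≗ {m} λ i → sum-cong-≗ {n} λ j → cong F (sym (+-assoc n (toℕ i * n) (toℕ j)))) ⟩
  ∑[ i < suc m ] ∑[ j < n ] F (toℕ i * n + toℕ j) ∎
  where open ≡-Reasoning

residue-of : ∀ {d m o c X} .{{_ : NonZero d}} →
  d ∣ m → d ∣ o → m + X ≡ c + o → c < d → X % d ≡ c
residue-of {d} {m} {o} {c} {X} d∣m d∣o eq c<d = begin
  X % d        ≡⟨ %-remove-+ˡ X d∣m ⟨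
  (m + X) % d  ≡⟨ cong (_% d) eq ⟩
  (c + o) % d  ≡⟨ %-remove-+ʳ c d∣o ⟩
  c % d        ≡⟨ m<n⇒m%n≡m c<d ⟩
  c            ∎
  where open ≡-Reasoning

residue+modulus≤ : ∀ {X d c} .{{_ : NonZero d}} → X % d ≡ c → c < X → c + d ≤ X
residue+modulus≤ {X} {d} {c} X%d≡c c<X with X / d | m≡m%n+[m/n]*n X d
... | zero  | X≡ = contradiction (trans X≡ (trans (+-identityʳ _) X%d≡c)) (>⇒≢ c<X)
... | suc j | X≡ = begin
  c + d              ≤⟨ +-monoʳ-≤ c (m≤m+n d (j * d)) ⟩
  c + suc j * d      ≡⟨ cong (_+ suc j * d) X%d≡c ⟨
  X % d + suc j * d  ≡⟨ X≡ ⟨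
  X                  ∎
  where open ≤-Reasoning

divmod-unique : ∀ {n d r A B} .{{_ : NonZero n}} →
  d < n → r < n → d + A * n ≡ r + B * n → d ≡ r × A ≡ B
divmod-unique {n} {d} {r} {A} {B} d<n r<n eq = d≡r , A≡B
  where
  d≡r : d ≡ r
  d≡r = trans (sym (m<n⇒m%n≡m d<n))
    (residue-of (n∣m*n A) (n∣m*n B) (trans (+-comm (A * n) d) eq) r<n)
  A≡B : A ≡ B
  A≡B = *-cancelʳ-≡ A B n (+-cancelˡ-≡ r _ _ (subst (λ z → z + A * n ≡ r + B * n) d≡r eq))

carry-split : ∀ {n r₁ x r₂ A B} .{{_ : NonZero n}} → r₁ < n → x < n → r₂ < n →
  r₁ + x + A * n ≡ r₂ + B * n →
  (r₁ + x ≡ r₂ × A ≡ B) ⊎ (r₁ + x ≡ n + r₂ × suc A ≡ B)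
carry-split {n} {r₁} {x} {r₂} {A} {B} r₁<n x<n r₂<n eq with r₁ + x <? n
... | yes r₁+x<n = inj₁ (divmod-unique r₁+x<n r₂<n eq)
... | no r₁+x≮n with m≤n⇒∃[o]m+o≡n (≮⇒≥ r₁+x≮n)
...   | d , n+d≡r₁+x with divmod-unique d<n r₂<n eq′
  where
  d<n : d < n
  d<n = +-cancelˡ-< n d n (subst (_< n + n) (sym n+d≡r₁+x) (+-mono-< r₁<n x<n))
  eq′ : d + suc A * n ≡ r₂ + B * n
  eq′ = begin
    d + (n + A * n)  ≡⟨ x∙yz≈y∙xz d n (A * n) ⟩
    n + (d + A * n)  ≡⟨ +-assoc n d (A * n) ⟨
    n + d + A * n    ≡⟨ cong (_+ A * n) n+d≡r₁+x ⟩
    r₁ + x + A * n   ≡⟨ eq ⟩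
    r₂ + B * n       ∎
    where open ≡-Reasoning
...     | d≡r₂ , sucA≡B = inj₂ (trans (sym n+d≡r₁+x) (cong (n +_) d≡r₂) , sucA≡B)

complement-mod : ∀ d r .{{_ : NonZero d}} → ∃ λ m → m < d × d ∣ r + m
complement-mod d r with r % d | m≡m%n+[m/n]*n r d | m%n<n r d
... | zero  | r≡ | _    = 0 , >-nonZero⁻¹ d , divides (r / d) (trans (+-identityʳ r) r≡)
... | suc ρ | r≡ | 1+ρ<d =
  d ∸ suc ρ , ∸-monoʳ-< {o = 0} z<s (<⇒≤ 1+ρ<d) , divides (suc (r / d)) (begin
    r + (d ∸ suc ρ)                  ≡⟨ cong (_+ (d ∸ suc ρ)) r≡ ⟩
    suc ρ + r / d * d + (d ∸ suc ρ)  ≡⟨ xy∙z≈xz∙y (suc ρ) (r / d * d) (d ∸ suc ρ) ⟩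
    suc ρ + (d ∸ suc ρ) + r / d * d  ≡⟨ cong (_+ r / d * d) (m+[n∸m]≡n (<⇒≤ 1+ρ<d)) ⟩
    d + r / d * d                    ∎)
  where open ≡-Reasoning

divmod-injective : ∀ {U V n} .{{_ : NonZero n}} → U % n ≡ V % n → U / n ≡ V / n → U ≡ V
divmod-injective {U} {V} {n} r≡ q≡ = begin
  U                  ≡⟨ m≡m%n+[m/n]*n U n ⟩
  U % n + U / n * n  ≡⟨ cong₂ (λ r m → r + m * n) r≡ q≡ ⟩
  V % n + V / n * n  ≡⟨ m≡m%n+[m/n]*n V n ⟨
  V                  ∎
  where open ≡-Reasoning

divmod-of : ∀ {n r} m .{{_ : NonZero n}} → r < n → (m * n + r) % n ≡ r × (m * n + r) / n ≡ m
divmod-of {n} {r} m r<n = divmod-unique (m%n<n (m * n + r) n) r<n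
  (trans (sym (m≡m%n+[m/n]*n (m * n + r) n)) (+-comm (m * n) r))

n∸1<n : ∀ {n} → 0 < n → n ∸ 1 < n
n∸1<n {suc n} _ = n<1+n n

record WalkShape (n a m u v : ℕ) : Set where
  constructor shape
  field
    ones jumps laps : ℕ
    length≡   : ones + jumps ≡ m
    endpoint≡ : u + (ones + jumps * a) ≡ v + laps * n

arc-then : ∀ {n w X v} u c t t′ →
  u + c ≡ w + t * n → w + X ≡ v + t′ * n → u + (c + X) ≡ v + (t′ + t) * n
arc-then {n} {w} {X} {v} u c t t′ arc rest = begin
  u + (c + X)           ≡⟨ +-assoc u c X ⟨
  u + c + X             ≡⟨ cong (_+ X) arc ⟩
  w + t * n + X         ≡⟨ xy∙z≈xz∙y w (t * n) X ⟩
  w + X + t * n         ≡⟨ cong (_+ t * n) rest ⟩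
  v + t′ * n + t * n    ≡⟨ +-assoc v (t′ * n) (t * n) ⟩
  v + (t′ * n + t * n)  ≡⟨ cong (v +_) (*-distribʳ-+ n t′ t) ⟨
  v + (t′ + t) * n      ∎
  where open ≡-Reasoning

walk-shape : ∀ {n a m u v} → Walk n a m u v → WalkShape n a m (toℕ u) (toℕ v)
walk-shape nil = shape 0 0 0 refl refl
walk-shape (cons {u = u} (arc1 t arc) rest) with walk-shape rest
... | shape x y t′ len end = shape (suc x) y (t′ + t) (cong suc len)
  (arc-then (toℕ u) 1 t t′ arc end)
walk-shape {a = a} (cons {u = u} (arca t arc) rest) with walk-shape rest
... | shape x y t′ len end = shape x (suc y) (t′ + t) (trans (+-suc x y) (cong suc len))
  (trans (cong (toℕ u +_) (x∙yz≈y∙xz x a (y * a))) (arc-then (toℕ u) a t t′ arc end))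

cyclic-predecessor : ∀ {n} (u : Fin n) → ∃₂ λ (v : Fin n) c → suc (toℕ v) ≡ toℕ u + c * n
cyclic-predecessor {suc n} zero    =
  fromℕ n , 1 , cong suc (trans (toℕ-fromℕ n) (sym (+-identityʳ n)))
cyclic-predecessor {suc n} (suc i) =
  inject₁ i , 0 , cong suc (trans (toℕ-inject₁ i) (sym (+-identityʳ _)))

ecc≥a∸1 : ∀ {n a} → a ∣ n → (u : Fin n) → EccGe n a u (a ∸ 1)
ecc≥a∸1 {n} {a} a∣n u with cyclic-predecessor u
... | v , c , pred≡ = v , far
  where
  far : DistGe n a u v (a ∸ 1)
  far m walk with walk-shape walk
  ... | shape x y t len end = subst (a ∸ 1 ≤_) len (≤-trans (∸-monoˡ-≤ 1 (∣⇒≤ a∣1+x)) (m≤m+n x y))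
    where
    laps : suc (x + y * a) ≡ (c + t) * n
    laps = +-cancelˡ-≡ (toℕ u) _ _ (begin
      toℕ u + suc (x + y * a)   ≡⟨ +-suc (toℕ u) _ ⟩
      suc (toℕ u + (x + y * a)) ≡⟨ cong suc end ⟩
      suc (toℕ v) + t * n       ≡⟨ cong (_+ t * n) pred≡ ⟩
      toℕ u + c * n + t * n     ≡⟨ +-assoc (toℕ u) (c * n) (t * n) ⟩
      toℕ u + (c * n + t * n)   ≡⟨ cong (toℕ u +_) (*-distribʳ-+ n c t) ⟨
      toℕ u + (c + t) * n       ∎)
      where open ≡-Reasoning
    a∣1+x : a ∣ suc x
    a∣1+x = ∣m+n∣m⇒∣n
      (subst (a ∣_) (trans (sym laps) (+-comm (suc x) (y * a))) (∣n⇒∣m*n (c + t) a∣n))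
      (n∣m*n y)

record Admissible (q k s : ℕ) (w : ℕ → ℕ) : Set where
  field
    before-positive : ∀ {r₁ r₂} → r₁ < r₂ → 0 < w r₂ → w r₁ < q
    up-to-kq        : ∀ {r} → r ≤ k * q → w r < q + s
    beyond-kq       : ∀ {r} → k * q < r → r < k * q + 1 + s → w r < s

module DiagonalBroadcast (q k s : ℕ) .{{_ : NonZero q}} (s<q : s < q) (1≤k : 1 ≤ k)
                         (w : ℕ → ℕ) (admissible : Admissible q k s w) where

  open Admissible admissible

  a : ℕ
  a = k * q + 1 + s

  s<a : s < a
  s<a = subst (s <_) (sym (+-assoc (k * q) 1 s)) (m≤n+m (suc s) (k * q))

  q+s≤a : q + s ≤ a
  q+s≤a = +-monoˡ-≤ s (≤-trans q≤kq (m≤m+n (k * q) 1))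
    where
    q≤kq : q ≤ k * q
    q≤kq = subst (_≤ k * q) (*-identityˡ q) (*-monoˡ-≤ q 1≤k)

  instance
    a-nonZero : NonZero a
    a-nonZero = >-nonZero (m<n⇒0<n s<a)

  weight<a : ∀ {r} → r < a → w r < a
  weight<a {r} r<a with r ≤? k * q
  ... | yes r≤kq = <-≤-trans (up-to-kq r≤kq) q+s≤a
  ... | no r≰kq  = <-trans (beyond-kq (≰⇒> r≰kq) r<a) s<a

  OnDiagonal : ℕ → Set
  OnDiagonal U = q ∣ U % a + U / a

  broadcastAt : ℕ → ℕ
  broadcastAt U with q ∣? U % a + U / a
  ... | yes _ = w (U % a)
  ... | no  _ = 0

  broadcastAt≤weight : ∀ U → broadcastAt U ≤ w (U % a)
  broadcastAt≤weight U with q ∣? U % a + U / a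
  ... | yes _ = ≤-refl
  ... | no  _ = z≤n

  broadcastAt-on-diagonal : ∀ {U} → OnDiagonal U → broadcastAt U ≡ w (U % a)
  broadcastAt-on-diagonal {U} diag with q ∣? U % a + U / a
  ... | yes _    = refl
  ... | no  ¬diag = contradiction diag ¬diag

  broadcastAt-support : ∀ {U} → 0 < broadcastAt U → OnDiagonal U × broadcastAt U ≡ w (U % a)
  broadcastAt-support {U} positive with q ∣? U % a + U / a
  ... | yes diag = diag , refl

  record DiagonalCell : Set where
    field
      col row  : ℕ
      col<a    : col < a
      row<q    : row < q
      diagonal : q ∣ col + row

  module Separation (c₁ c₂ : DiagonalCell) where
    open DiagonalCell c₁
      renaming (col to r₁; row to m₁; col<a to r₁<a; row<q to m₁<q; diagonal to diag₁)
    open DiagonalCell c₂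
      renaming (col to r₂; row to m₂; col<a to r₂<a; row<q to m₂<q; diagonal to diag₂)

    residue-without-carry : ∀ x y t → r₁ + x ≡ r₂ → m₁ + y ≡ m₂ + t * q → (x + y) % q ≡ 0
    residue-without-carry x y t r₁+x≡r₂ m₁+y≡ =
      residue-of diag₁ (∣m∣n⇒∣m+n diag₂ (n∣m*n t)) (begin
        r₁ + m₁ + (x + y)  ≡⟨ interchange r₁ m₁ x y ⟩
        r₁ + x + (m₁ + y)  ≡⟨ cong₂ _+_ r₁+x≡r₂ m₁+y≡ ⟩
        r₂ + (m₂ + t * q)  ≡⟨ +-assoc r₂ m₂ (t * q) ⟨
        r₂ + m₂ + t * q    ∎) (>-nonZero⁻¹ q)
      where open ≡-Reasoning

    without-carry : ∀ x y t → ¬ (r₁ ≡ r₂ × m₁ ≡ m₂) → 0 < w r₂ →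
      r₁ + x ≡ r₂ → m₁ + y ≡ m₂ + t * q → w r₁ < x + y
    without-carry zero y t distinct _ r₁+0≡r₂ m₁+y≡
      with m%n≡0⇒n∣m y q (residue-without-carry 0 y t r₁+0≡r₂ m₁+y≡)
    ... | divides j refl = contradiction (r₁≡r₂ , m₁≡m₂) distinct
      where
      r₁≡r₂ : r₁ ≡ r₂
      r₁≡r₂ = trans (sym (+-identityʳ r₁)) r₁+0≡r₂
      m₁≡m₂ : m₁ ≡ m₂
      m₁≡m₂ = proj₁ (divmod-unique {A = j} {B = t} m₁<q m₂<q m₁+y≡)
    without-carry (suc x′) y t _ positive r₁+x≡r₂ m₁+y≡ =
      <-≤-trans (before-positive r₁<r₂ positive)
                (residue+modulus≤ (residue-without-carry (suc x′) y t r₁+x≡r₂ m₁+y≡) z<s)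
      where
      r₁<r₂ : r₁ < r₂
      r₁<r₂ = subst (r₁ <_) r₁+x≡r₂ (m<m+n r₁ z<s)

    residue-with-carry : ∀ x y t → r₁ + x ≡ a + r₂ → suc (m₁ + y) ≡ m₂ + t * q → (x + y) % q ≡ s
    residue-with-carry x y t r₁+x≡a+r₂ 1+m₁+y≡ =
      residue-of diag₁ (∣m∣n⇒∣m+n (∣m∣n⇒∣m+n (n∣m*n k) diag₂) (n∣m*n t)) (suc-injective (begin
        suc (r₁ + m₁ + (x + y))            ≡⟨ cong suc (interchange r₁ m₁ x y) ⟩
        suc (r₁ + x + (m₁ + y))            ≡⟨ +-suc (r₁ + x) (m₁ + y) ⟨
        r₁ + x + suc (m₁ + y)              ≡⟨ cong₂ _+_ r₁+x≡a+r₂ 1+m₁+y≡ ⟩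
        k * q + 1 + s + r₂ + (m₂ + t * q)  ≡⟨ shuffle (k * q) s r₂ m₂ (t * q) ⟩
        suc (s + (k * q + (r₂ + m₂) + t * q)) ∎)) s<q
      where
      open ≡-Reasoning
      shuffle : ∀ K s r m T → K + 1 + s + r + (m + T) ≡ suc (s + (K + (r + m) + T))
      shuffle = solve-∀

    with-carry : ∀ x y t → r₁ + x ≡ a + r₂ → suc (m₁ + y) ≡ m₂ + t * q → w r₁ < x + y
    with-carry x y t r₁+x≡a+r₂ 1+m₁+y≡ with r₁ ≤? k * q
    ... | yes r₁≤kq = <-≤-trans (up-to-kq r₁≤kq) (subst (_≤ x + y) (+-comm s q)
                        (residue+modulus≤ residue (<-≤-trans s<x (m≤m+n x y))))
      where
      residue : (x + y) % q ≡ s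
      residue = residue-with-carry x y t r₁+x≡a+r₂ 1+m₁+y≡
      s<x : s < x
      s<x = +-cancelˡ-≤ (k * q) (suc s) x (begin
        k * q + suc s  ≡⟨ +-assoc (k * q) 1 s ⟨
        a              ≤⟨ m≤m+n a r₂ ⟩
        a + r₂         ≡⟨ r₁+x≡a+r₂ ⟨
        r₁ + x         ≤⟨ +-monoˡ-≤ x r₁≤kq ⟩
        k * q + x      ∎)
        where open ≤-Reasoning
    ... | no r₁≰kq = <-≤-trans (beyond-kq (≰⇒> r₁≰kq) r₁<a) (subst (_≤ x + y)
                       (residue-with-carry x y t r₁+x≡a+r₂ 1+m₁+y≡) (m%n≤m (x + y) q))

    separated : ∀ x y t → ¬ (r₁ ≡ r₂ × m₁ ≡ m₂) → 0 < w r₂ →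
      r₁ + x + (m₁ + y) * a ≡ r₂ + (m₂ + t * q) * a → w r₁ < x + y
    separated x y t distinct positive eq with a ≤? x
    ... | yes a≤x = <-≤-trans (weight<a r₁<a) (≤-trans a≤x (m≤m+n x y))
    ... | no a≰x with carry-split {A = m₁ + y} {B = m₂ + t * q} r₁<a (≰⇒> a≰x) r₂<a eq
    ...   | inj₁ (r₁+x≡r₂ , m₁+y≡)     = without-carry x y t distinct positive r₁+x≡r₂ m₁+y≡
    ...   | inj₂ (r₁+x≡a+r₂ , 1+m₁+y≡) = with-carry x y t r₁+x≡a+r₂ 1+m₁+y≡

  cell : (u : Fin (q * a)) → OnDiagonal (toℕ u) → DiagonalCell
  cell u diag = record
    { col = toℕ u % a ; row = toℕ u / a
    ; col<a = m%n<n (toℕ u) a ; row<q = m<n*o⇒m/o<n (toℕ<n u) ; diagonal = diag }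

  broadcast : Fin (q * a) → ℕ
  broadcast = broadcastAt ∘ toℕ

  independent : ∀ u v → u ≢ v → 0 < broadcast u → 0 < broadcast v →
                DistGt (q * a) a u v (broadcast u)
  independent u v u≢v 0<bu 0<bv m walk
    with broadcastAt-support 0<bu | broadcastAt-support 0<bv | walk-shape walk
  ... | diag₁ , bu≡ | diag₂ , bv≡ | shape x y t len end =
    subst₂ _<_ (sym bu≡) len
      (Separation.separated (cell u diag₁) (cell v diag₂) x y t
        (λ (r≡ , m≡) → u≢v (toℕ-injective (divmod-injective {n = a} r≡ m≡)))
        (subst (0 <_) bv≡ 0<bv)
        (begin
          U % a + x + (U / a + y) * a      ≡⟨ regroupˡ (U % a) (U / a) x y a ⟩
          U % a + U / a * a + (x + y * a)  ≡⟨ cong (_+ (x + y * a)) (m≡m%n+[m/n]*n U a) ⟨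
          U + (x + y * a)                  ≡⟨ end ⟩
          V + t * (q * a)                  ≡⟨ cong (_+ t * (q * a)) (m≡m%n+[m/n]*n V a) ⟩
          V % a + V / a * a + t * (q * a)  ≡⟨ regroupʳ (V % a) (V / a) t q a ⟩
          V % a + (V / a + t * q) * a      ∎))
    where
    open ≡-Reasoning
    U = toℕ u
    V = toℕ v
    regroupˡ : ∀ r m x y a → r + x + (m + y) * a ≡ r + m * a + (x + y * a)
    regroupˡ = solve-∀
    regroupʳ : ∀ r m t q a → r + m * a + t * (q * a) ≡ r + (m + t * q) * a
    regroupʳ = solve-∀

  bounded : ∀ u → EccGe (q * a) a u (broadcast u)
  bounded u with ecc≥a∸1 (n∣m*n q) u
  ... | v , far = v , λ m walk → ≤-trans broadcast≤a∸1 (far m walk)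
    where
    broadcast≤a∸1 : broadcast u ≤ a ∸ 1
    broadcast≤a∸1 = ≤-trans (broadcastAt≤weight (toℕ u)) (<⇒≤pred (weight<a (m%n<n (toℕ u) a)))

  weight≤column : ∀ {r} → r < a → w r ≤ ∑[ i < q ] broadcastAt (toℕ i * a + r)
  weight≤column {r} r<a with complement-mod q r
  ... | m , m<q , q∣r+m = begin
    w r                                     ≡⟨ cong w col≡ ⟨
    w ((m * a + r) % a)                     ≡⟨ broadcastAt-on-diagonal diag ⟨
    broadcastAt (m * a + r)                 ≡⟨ cong (λ i → broadcastAt (i * a + r)) (toℕ-fromℕ< m<q) ⟨
    broadcastAt (toℕ (fromℕ< m<q) * a + r)  ≤⟨ ≤-∑ (λ i → broadcastAt (toℕ i * a + r)) (fromℕ< m<q) ⟩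
    ∑[ i < q ] broadcastAt (toℕ i * a + r)  ∎
    where
    open ≤-Reasoning
    col≡ = proj₁ (divmod-of m r<a)
    diag : OnDiagonal (m * a + r)
    diag = subst₂ (λ r′ m′ → q ∣ r′ + m′) (sym col≡) (sym (proj₂ (divmod-of m r<a))) q∣r+m

  cost≥ : ∑[ r < a ] w (toℕ r) ≤ cost broadcast
  cost≥ = begin
    ∑[ r < a ] w (toℕ r)
      ≤⟨ ∑-mono-≤ (λ r → weight≤column (toℕ<n r)) ⟩
    ∑[ r < a ] ∑[ i < q ] broadcastAt (toℕ i * a + toℕ r)
      ≡⟨ ∑-comm {q} {a} (λ i r → broadcastAt (toℕ i * a + toℕ r)) ⟨
    ∑[ i < q ] ∑[ r < a ] broadcastAt (toℕ i * a + toℕ r)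
      ≡⟨ ∑-rows q a broadcastAt ⟨
    ∑[ i < q * a ] broadcast i
      ≡⟨ cost≡∑ broadcast ⟨
    cost broadcast ∎
    where open ≤-Reasoning

  βb≥∑weights : βb≥ (q * a) a (∑[ r < a ] w (toℕ r))
  βb≥∑weights = broadcast , record { bounded = bounded ; independent = independent } , cost≥

-- Column kq may carry q rather than q − 1 only when s = 1: the single column after it then
-- carries s − 1 = 0, so no broadcasting column lies to its right.
extra : ℕ → ℕ
extra 1 = 1
extra _ = 0

extra≤ : ∀ s → extra s ≤ s
extra≤ 0             = z≤n
extra≤ 1             = ≤-refl
extra≤ (suc (suc _)) = z≤n

extra≡0 : ∀ {s} → 0 < s ∸ 1 → extra s ≡ 0
extra≡0 {suc (suc _)} _ = refl

weight : (q k s : ℕ) → ℕ → ℕ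
weight q k s r with <-cmp r (k * q)
... | tri< _ _ _ = q ∸ 1
... | tri≈ _ _ _ = q ∸ 1 + extra s
... | tri> _ _ _ = s ∸ 1

module _ (q k s : ℕ) where

  weight-below : ∀ {r} → r < k * q → weight q k s r ≡ q ∸ 1
  weight-below {r} r<kq with <-cmp r (k * q)
  ... | tri< _ _ _     = refl
  ... | tri≈ r≮kq _ _  = contradiction r<kq r≮kq
  ... | tri> r≮kq _ _  = contradiction r<kq r≮kq

  weight-pivot : weight q k s (k * q) ≡ q ∸ 1 + extra s
  weight-pivot with <-cmp (k * q) (k * q)
  ... | tri< _ kq≢kq _ = contradiction refl kq≢kq
  ... | tri≈ _ _ _     = refl
  ... | tri> _ kq≢kq _ = contradiction refl kq≢kq

  weight-above : ∀ {r} → k * q < r → weight q k s r ≡ s ∸ 1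
  weight-above {r} kq<r with <-cmp r (k * q)
  ... | tri< _ _ kq≮r = contradiction kq<r kq≮r
  ... | tri≈ _ _ kq≮r = contradiction kq<r kq≮r
  ... | tri> _ _ _    = refl

  weight-admissible : .{{_ : NonZero q}} → s < q → Admissible q k s (weight q k s)
  weight-admissible s<q = record
    { before-positive = before-positive ; up-to-kq = up-to-kq ; beyond-kq = beyond-kq }
    where
    q∸1<q : q ∸ 1 < q
    q∸1<q = n∸1<n (>-nonZero⁻¹ q)
    before-positive : ∀ {r₁ r₂} → r₁ < r₂ → 0 < weight q k s r₂ → weight q k s r₁ < q
    before-positive {r₁} r₁<r₂ positive with <-cmp r₁ (k * q)
    ... | tri< _ _ _    = q∸1<q
    ... | tri≈ _ refl _ = subst (_< q) (sym pivot≡q∸1) (q∸1<q)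
      where
      pivot≡q∸1 : q ∸ 1 + extra s ≡ q ∸ 1
      pivot≡q∸1 = trans (cong (q ∸ 1 +_) (extra≡0 (subst (0 <_) (weight-above r₁<r₂) positive)))
                        (+-identityʳ (q ∸ 1))
    ... | tri> _ _ _    = ≤-<-trans (m∸n≤m s 1) s<q
    up-to-kq : ∀ {r} → r ≤ k * q → weight q k s r < q + s
    up-to-kq {r} r≤kq with <-cmp r (k * q)
    ... | tri< _ _ _     = <-≤-trans q∸1<q (m≤m+n q s)
    ... | tri≈ _ _ _     = +-mono-<-≤ q∸1<q (extra≤ s)
    ... | tri> _ _ kq<r  = contradiction r≤kq (<⇒≱ kq<r)
    beyond-kq : ∀ {r} → k * q < r → r < k * q + 1 + s → weight q k s r < s
    beyond-kq {r} kq<r r<a = subst (_< s) (sym (weight-above kq<r)) (n∸1<n 0<s)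
      where
      0<s : 0 < s
      0<s = +-cancelˡ-< (k * q + 1) 0 s (begin-strict
        k * q + 1 + 0  ≡⟨ +-identityʳ (k * q + 1) ⟩
        k * q + 1      ≡⟨ +-comm (k * q) 1 ⟩
        suc (k * q)    ≤⟨ kq<r ⟩
        r              <⟨ r<a ⟩
        k * q + 1 + s  ∎)
        where open ≤-Reasoning

  ∑-weight : ∑[ r < k * q + 1 + s ] weight q k s (toℕ r)
             ≡ (k * q + 1 + s ∸ s) * (q ∸ 1) + extra s + s * (s ∸ 1)
  ∑-weight = begin
    ∑[ r < k * q + 1 + s ] w (toℕ r)
      ≡⟨ ∑-++ (k * q + 1) s w ⟩
    ∑[ r < k * q + 1 ] w (toℕ r) + ∑[ j < s ] w (k * q + 1 + toℕ j)
      ≡⟨ cong (_+ ∑[ j < s ] w (k * q + 1 + toℕ j)) (∑-++ (k * q) 1 w) ⟩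
    ∑[ r < k * q ] w (toℕ r) + (w (k * q + 0) + 0) + ∑[ j < s ] w (k * q + 1 + toℕ j)
      ≡⟨ cong₂ _+_ (cong₂ _+_ below pivot) above ⟩
    k * q * (q ∸ 1) + (q ∸ 1 + extra s) + s * (s ∸ 1)
      ≡⟨ regroup (k * q) (q ∸ 1) (extra s) (s * (s ∸ 1)) ⟨
    (k * q + 1) * (q ∸ 1) + extra s + s * (s ∸ 1)
      ≡⟨ cong (λ c → c * (q ∸ 1) + extra s + s * (s ∸ 1)) (m+n∸n≡m (k * q + 1) s) ⟨
    (k * q + 1 + s ∸ s) * (q ∸ 1) + extra s + s * (s ∸ 1) ∎
    where
    open ≡-Reasoning
    w = weight q k s
    below : ∑[ r < k * q ] w (toℕ r) ≡ k * q * (q ∸ 1)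
    below = trans (sum-cong-≗ {k * q} (λ r → weight-below (toℕ<n r))) (∑-const (k * q) (q ∸ 1))
    pivot : w (k * q + 0) + 0 ≡ q ∸ 1 + extra s
    pivot = trans (+-identityʳ _) (trans (cong w (+-identityʳ (k * q))) weight-pivot)
    above : ∑[ j < s ] w (k * q + 1 + toℕ j) ≡ s * (s ∸ 1)
    above = trans (sum-cong-≗ {s} (λ j → weight-above (kq<kq+1+ (toℕ j)))) (∑-const s (s ∸ 1))
      where
      kq<kq+1+ : ∀ j → k * q < k * q + 1 + j
      kq<kq+1+ j = subst (k * q <_) (sym (+-assoc (k * q) 1 j)) (m<m+n (k * q) z<s)
    regroup : ∀ K Q e S → (K + 1) * Q + e + S ≡ K * Q + (Q + e) + S
    regroup = solve-∀

proposition23 : (n a q k s : ℕ) → n ≡ q * a → 3 ≤ q → q < a ∸ 1 →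
    a ≡ k * q + 1 + s → 1 ≤ k → s ≤ q ∸ 1 →
    (s ≡ 0 → βb≥ n a (a * (q ∸ 1)))
    × (s ≡ 1 → βb≥ n a ((a ∸ 1) * (q ∸ 1) + 1))
    × (2 ≤ s → βb≥ n a ((a ∸ s) * (q ∸ 1) + s * (s ∸ 1)))
proposition23 _ _ zero _ _ _ () _ _ _ _
proposition23 _ _ (suc q′) k s refl _ _ refl 1≤k s≤q′ =
    (λ { refl → subst (βb≥ _ _) (trans (+-identityʳ _) (+-identityʳ _)) total })
  , (λ { refl → subst (βb≥ _ _) (+-identityʳ _) total })
  , (λ { (s≤s (s≤s _)) → subst (βb≥ _ _) (cong (_+ s * (s ∸ 1)) (+-identityʳ _)) total })
  where
  total : βb≥ _ (k * suc q′ + 1 + s) ((k * suc q′ + 1 + s ∸ s) * q′ + extra s + s * (s ∸ 1))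
  total = subst (βb≥ _ _) (∑-weight (suc q′) k s)
    (DiagonalBroadcast.βb≥∑weights (suc q′) k s (s≤s s≤q′) 1≤k (weight (suc q′) k s)
      (weight-admissible (suc q′) k s (s≤s s≤q′)))
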